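{- Let $\mathcal{M}=\langle S,T,V,U,\sim_i,\approx\rangle$ be a dependence epistemic model, $s\in S$, and $X,Y\subseteq\mathbb{V}$ finite. Then $\mathcal{M},s\vDash\mathcal{D}_g(X,Y)$ iff some $W\in\mathcal{P}_g(s)$ is an evidence of $\langle X,Y\rangle$; and $\mathcal{M},s\vDash\mathcal{D}_l(X,Y)$ iff some $W\in\mathcal{P}_l(s)$ is an evidence of $\langle X,Y\rangle$.
   Context: Fix a countable set $\mathbb{P}$ of propositions and a countable set $\mathbb{V}$ of variables. A dependence epistemic model is $\mathcal{M}=\langle S,T,V,U,\sim_i,\approx\rangle$ where $S$ is a set of worlds, $T:S\times\mathbb{P}\to\{0,1\}$, $V\supseteq\mathbb{V}$ is a countable set of variables, $U:S\times V\to\mathbb{N}$, and $\sim_i,\approx$ are equivalence relations on $S$. For $s,t\in S$ and $X\subseteq V$, write $X_s=X_t$ iff $U(s,x)=U(t,x)$ for all $x\in X$, and $X_s\neq X_t$ otherwise. Semantics (for finite $X,Y\subseteq\mathbb{V}$): $\mathcal{M},s\vDash\mathcal{D}_g(X,Y)$ iff there exist $u,v\in S$ with $u\approx v\approx s$, $(V\setminus(X\cup Y))_u=(V\setminus(X\cup Y))_v$, $X_u\neq X_v$ and $Y_u\neq Y_v$; $\mathcal{M},s\vDash\mathcal{D}_l(X,Y)$ iff there exists $t\in S$ with $t\approx s$, $(V\setminus(X\cup Y))_t=(V\setminus(X\cup Y))_s$, $X_t\neq X_s$ and $Y_t\neq Y_s$. For $u,v\in S$, $\Delta(u,v)=\{x\in\mathbb{V}\mid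 U(u,x)\neq U(v,x)\}$ if $(V\setminus\mathbb{V})_u=(V\setminus\mathbb{V})_v$, and $\Delta(u,v)=\emptyset$ otherwise. $W$ is an evidence of $\langle X,Y\rangle$ iff $W\cap X\neq\emptyset$, $W\cap Y\neq\emptyset$, $W\subseteq X\cup Y$. Define $\mathcal{P}_g(s)=\{\Delta(u,v)\mid u,v\in S,\ u\approx v\approx s,\ \Delta(u,v)\text{ nonempty finite}\}$ and $\mathcal{P}_l(s)=\{\Delta(t,s)\mid t\in S,\ t\approx s,\ \Delta(t,s)\text{ nonempty finite}\}$. -}

module Defs where

open import Data.Nat using (ℕ)
open import Data.Bool using (Bool)
open import Data.Empty using (⊥)
open import Data.Product using (Σ; _×_; ∃; ∃-syntax)
open import Data.Sum using (_⊎_; inj₁; inj₂)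
open import Data.List using (List)
open import Data.List.Membership.Propositional using (_∈_; _∉_)
open import Function.Definitions using (Injective)
open import Relation.Nullary using (¬_)
open import Relation.Binary.Core using (Rel)
open import Relation.Binary.Structures using (IsEquivalence)
open import Relation.Binary.PropositionalEquality using (_≡_; _≢_)
open import Level using (0ℓ; suc)

Countable : Set → Set
Countable A = Σ (A → ℕ) λ f → Injective _≡_ _≡_ f

-- The full variable set V ⊇ 𝕍 is represented as the disjoint union 𝕍 ⊎ Extra,
-- where Extra is the set V ∖ 𝕍 of additional variables.
record DEM (𝕍 ℙ : Set) : Set₁ where
  field
    S      : Set
    T      : S → ℙ → Bool
    Extra  : Set
    Extra-countable : Countable Extra  -- V is countable (given 𝕍 countable)
    U      : S → (𝕍 ⊎ Extra) → ℕ
    Agent  : Set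
    _∼[_]_ : S → Agent → S → Set
    ∼-equiv : ∀ i → IsEquivalence (λ s t → s ∼[ i ] t)
    _≈_    : Rel S 0ℓ
    ≈-equiv : IsEquivalence _≈_

module _ {𝕍 ℙ : Set} (M : DEM 𝕍 ℙ) where
  open DEM M

  V : Set
  V = 𝕍 ⊎ Extra

  -- membership of a variable of V in X ∪ Y (X, Y ⊆ 𝕍 finite, given as lists)
  _∈∪_ : V → (List 𝕍 × List 𝕍) → Set
  inj₁ x ∈∪ (X Data.Product., Y) = x ∈ X ⊎ x ∈ Y
  inj₂ e ∈∪ _ = ⊥

  AgreeOutside : List 𝕍 → List 𝕍 → S → S → Set
  AgreeOutside X Y u v = ∀ (z : V) → ¬ (z ∈∪ (X Data.Product., Y)) → U u z ≡ U v z

  AgreeOn : List 𝕍 → S → S → Set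
  AgreeOn X u v = ∀ x → x ∈ X → U u (inj₁ x) ≡ U v (inj₁ x)

  SatDg : S → List 𝕍 → List 𝕍 → Set
  SatDg s X Y = ∃[ u ] ∃[ v ] (u ≈ v × v ≈ s × AgreeOutside X Y u v
                               × ¬ AgreeOn X u v × ¬ AgreeOn Y u v)

  SatDl : S → List 𝕍 → List 𝕍 → Set
  SatDl s X Y = ∃[ t ] (t ≈ s × AgreeOutside X Y t s
                        × ¬ AgreeOn X t s × ¬ AgreeOn Y t s)

  Subset : Set₁
  Subset = 𝕍 → Set

  -- Δ(u,v): {x ∈ 𝕍 | U(u,x) ≠ U(v,x)} if (V∖𝕍)_u = (V∖𝕍)_v, else ∅
  Δ : S → S → Subset
  Δ u v x = (∀ (e : Extra) → U u (inj₂ e) ≡ U v (inj₂ e)) × (U u (inj₁ x) ≢ U v (inj₁ x))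

  _≐_ : Subset → Subset → Set
  W ≐ W′ = ∀ x → (W x → W′ x) × (W′ x → W x)

  NonEmpty : Subset → Set
  NonEmpty W = ∃[ x ] W x

  Finite : Subset → Set
  Finite W = ∃[ L ] (∀ x → W x → x ∈ L)

  Evidence : Subset → List 𝕍 → List 𝕍 → Set
  Evidence W X Y = (∃[ x ] (W x × x ∈ X)) × (∃[ y ] (W y × y ∈ Y))
                   × (∀ x → W x → x ∈ X ⊎ x ∈ Y)

  InPg : S → Subset → Set
  InPg s W = ∃[ u ] ∃[ v ] (u ≈ v × v ≈ s × W ≐ Δ u v
                            × NonEmpty (Δ u v) × Finite (Δ u v))

  InPl : S → Subset → Set
  InPl s W = ∃[ t ] (t ≈ s × W ≐ Δ t s × NonEmpty (Δ t s) × Finite (Δ t s))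

module Submission where

-- A pair u, v witnesses D(X, Y) exactly when Δ(u, v) is an evidence of ⟨X, Y⟩:
-- agreeing outside X ∪ Y says that the extra variables agree and Δ(u, v) ⊆ X ∪ Y,
-- and disagreeing on X and on Y says that Δ(u, v) meets X and Y; finiteness of
-- Δ(u, v) then comes for free from Δ(u, v) ⊆ X ∪ Y.  Both semantic clauses
-- quantify over such pairs (for D_l the pair is t, s).  Constructively, deriving
-- Δ(u, v) ⊆ X ∪ Y needs decidable membership in X and Y, which the countability
-- of 𝕍 provides.

open import Defs
open import Data.Nat.Properties using (_≟_; eq?)
open import Data.Product using (_×_; ∃-syntax; _,_; proj₁; proj₂)
open import Data.Sum using (_⊎_; inj₁; inj₂; [_,_])
open import Data.Empty using (⊥-elim)
open import Data.List using (List; _++_)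
open import Data.List.Membership.Propositional using (_∈_; find)
open import Data.List.Membership.Propositional.Properties using (∈-++⁺ˡ; ∈-++⁺ʳ)
open import Data.List.Membership.DecPropositional using (_∈?_)
import Data.List.Relation.Unary.All as All
open import Data.List.Relation.Unary.All.Properties using (¬All⇒Any¬)
open import Function using (_∘_)
open import Function.Bundles using (_⇔_; mk⇔; mk↣)
open import Relation.Binary.Definitions using (DecidableEquality)
open import Relation.Binary.PropositionalEquality using (_≢_)
open import Relation.Nullary using (¬_; yes; no)
open import Relation.Nullary.Decidable using (decidable-stable)

countable⇒≟ : {A : Set} → Countable A → DecidableEquality A
countable⇒≟ (_ , injective) = eq? (mk↣ injective)

module _ {𝕍 ℙ : Set} (M : DEM 𝕍 ℙ) where
  open DEM M using (S; U)

  DependenceWitness : List 𝕍 → List 𝕍 → S → S → Set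
  DependenceWitness X Y u v =
    AgreeOutside M X Y u v × ¬ AgreeOn M X u v × ¬ AgreeOn M Y u v

  ¬AgreeOn⇒∃≢ : ∀ {X u v} → ¬ AgreeOn M X u v
              → ∃[ x ] (x ∈ X × U u (inj₁ x) ≢ U v (inj₁ x))
  ¬AgreeOn⇒∃≢ {X} {u} {v} ¬agree =
    find (¬All⇒Any¬ (λ x → U u (inj₁ x) ≟ U v (inj₁ x)) X
                    (λ all → ¬agree (λ _ → All.lookup all)))

  ≐-refl : ∀ {W} → _≐_ M W W
  ≐-refl _ = (λ w → w) , (λ w → w)

  Evidence-resp-≐ : ∀ {W W′ X Y} → _≐_ M W W′ → Evidence M W X Y → Evidence M W′ X Y
  Evidence-resp-≐ W≐W′ ((x , wx , x∈X) , (y , wy , y∈Y) , W⊆X∪Y) =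
      (x , proj₁ (W≐W′ x) wx , x∈X)
    , (y , proj₁ (W≐W′ y) wy , y∈Y)
    , (λ z → W⊆X∪Y z ∘ proj₂ (W≐W′ z))

  evidence⇒nonEmpty : ∀ {W X Y} → Evidence M W X Y → NonEmpty M W
  evidence⇒nonEmpty ((x , wx , _) , _) = x , wx

  evidence⇒finite : ∀ {W X Y} → Evidence M W X Y → Finite M W
  evidence⇒finite {X = X} {Y} (_ , _ , W⊆X∪Y) =
    X ++ Y , λ z wz → [ ∈-++⁺ˡ , ∈-++⁺ʳ X ] (W⊆X∪Y z wz)

  module _ (_≟𝕍_ : DecidableEquality 𝕍) {X Y : List 𝕍} {u v : S} where

    Δ⊆X∪Y : AgreeOutside M X Y u v → ∀ z → Δ M u v z → z ∈ X ⊎ z ∈ Y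
    Δ⊆X∪Y agree z (_ , z≢) with _∈?_ _≟𝕍_ z X | _∈?_ _≟𝕍_ z Y
    ... | yes z∈X | _       = inj₁ z∈X
    ... | no _    | yes z∈Y = inj₂ z∈Y
    ... | no z∉X  | no z∉Y  = ⊥-elim (z≢ (agree (inj₁ z) [ z∉X , z∉Y ]))

    witness⇒Δ-evidence : DependenceWitness X Y u v → Evidence M (Δ M u v) X Y
    witness⇒Δ-evidence (agree , ¬agreeX , ¬agreeY) =
      Δ-meets ¬agreeX , Δ-meets ¬agreeY , Δ⊆X∪Y agree
      where
      Δ-meets : ∀ {Z} → ¬ AgreeOn M Z u v → ∃[ z ] (Δ M u v z × z ∈ Z)
      Δ-meets ¬agree with ¬AgreeOn⇒∃≢ ¬agree
      ... | z , z∈Z , z≢ = z , ((λ e → agree (inj₂ e) (λ ())) , z≢) , z∈Z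

  Δ-evidence⇒witness : ∀ {X Y u v} → Evidence M (Δ M u v) X Y → DependenceWitness X Y u v
  Δ-evidence⇒witness {X} {Y} {u} {v}
                     ((x , (extraAgree , x≢) , x∈X) , (y , (_ , y≢) , y∈Y) , Δ⊆) =
    agree , (λ agreeX → x≢ (agreeX x x∈X)) , (λ agreeY → y≢ (agreeY y y∈Y))
    where
    agree : AgreeOutside M X Y u v
    agree (inj₂ e) _     = extraAgree e
    agree (inj₁ z) z∉X∪Y =
      decidable-stable (U u (inj₁ z) ≟ U v (inj₁ z)) (λ z≢ → z∉X∪Y (Δ⊆ z (extraAgree , z≢)))

mainTheorem2 : (𝕍 ℙ : Set) → Countable 𝕍 → Countable ℙ → (M : DEM 𝕍 ℙ)
    → (s : DEM.S M) → (X Y : List 𝕍)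
    → (SatDg M s X Y ⇔ (∃[ W ] (InPg M s W × Evidence M W X Y)))
      × (SatDl M s X Y ⇔ (∃[ W ] (InPl M s W × Evidence M W X Y)))
mainTheorem2 𝕍 ℙ 𝕍-countable _ M s X Y = mk⇔ global⇒ global⇐ , mk⇔ local⇒ local⇐
  where
  evidence : ∀ {u v} → DependenceWitness M X Y u v → Evidence M (Δ M u v) X Y
  evidence = witness⇒Δ-evidence M (countable⇒≟ 𝕍-countable)

  global⇒ : SatDg M s X Y → ∃[ W ] (InPg M s W × Evidence M W X Y)
  global⇒ (u , v , u≈v , v≈s , w) =
    Δ M u v , (u , v , u≈v , v≈s , ≐-refl M , evidence⇒nonEmpty M ev , evidence⇒finite M ev) , ev
    where ev = evidence w

  global⇐ : ∃[ W ] (InPg M s W × Evidence M W X Y) → SatDg M s X Y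
  global⇐ (_ , (u , v , u≈v , v≈s , W≐Δ , _) , ev) =
    u , v , u≈v , v≈s , Δ-evidence⇒witness M (Evidence-resp-≐ M W≐Δ ev)

  local⇒ : SatDl M s X Y → ∃[ W ] (InPl M s W × Evidence M W X Y)
  local⇒ (t , t≈s , w) =
    Δ M t s , (t , t≈s , ≐-refl M , evidence⇒nonEmpty M ev , evidence⇒finite M ev) , ev
    where ev = evidence w

  local⇐ : ∃[ W ] (InPl M s W × Evidence M W X Y) → SatDl M s X Y
  local⇐ (_ , (t , t≈s , W≐Δ , _) , ev) =
    t , t≈s , Δ-evidence⇒witness M (Evidence-resp-≐ M W≐Δ ev)
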